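{- Let $q$ be a prime power, $n\ge 3$, and let $\mathcal{U}$ be an irreducible affine vector space partition of $\mathrm{PG}(n-1,q)$ of type $(n-1)^{m_{n-1}}\cdots 2^{m_2}1^{m_1}$. Then $m_{n-1}\le q-2$ or $m_{n-1}=q$. In the latter case $\mathcal{U}$ is not tight.
   Context: $\mathrm{PG}(n-1,q)$ denotes the projective geometry of $\mathbb{F}_q^n$; all dimensions are algebraic (vector space) dimensions, so points are $1$-dimensional subspaces and hyperplanes are $(n-1)$-dimensional subspaces. An affine vector space partition (avsp) of $\mathrm{PG}(n-1,q)$ is a set $\mathcal{U}=\{U_1,\dots,U_r\}$ of subspaces with $1\le \dim U_i\le n-1$ for which there exists a hyperplane $H_\infty$ such that no $U_i$ is contained in $H_\infty$ and every point not contained in $H_\infty$ is contained in exactly one $U_i$. Its type is $(n-1)^{m_{n-1}}\cdots 2^{m_2}1^{m_1}$, where $m_i$ is the number of elements of dimension $i$. For a subspace $W\not\le H_\infty$, a set of subspaces of $W$ none of which lies in $H_\infty$ is an avsp of $W$ if every point of $W$ outside $H_\infty$ lies in exactly one of them. $\mathcal{U}$ is reducible if there exist a subspace $W$ with $\dim W<n$ and a subset $S\subsetneq\{1,\dots,r\}$ with $|S|>1$ such that $\{U_i: i\in S\}$ is an avsp of $W$; otherwise it is irreducible. $\mathcal{U}$ is tight if $U_1\cap\cdots\cap U_r$ is the zero subspace. -}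

module Defs where

open import Data.Nat using (ℕ; zero; suc; _∸_; _<_; _≤_; _≟_)
open import Data.Fin using (Fin)
import Data.Fin as Fin
open import Data.Fin.Subset using (Subset; _∈_; _∉_; ∣_∣)
open import Data.Product using (Σ; ∃; _×_; _,_)
open import Relation.Binary.PropositionalEquality using (_≡_)
open import Relation.Nullary using (¬_; does)
open import Algebra.Core using (Op₁; Op₂)
open import Algebra.Structures using (IsCommutativeRing)
open import Function.Bundles using (_↔_)
open import Data.Bool using (if_then_else_)

-- A finite field with exactly q elements (q is then necessarily a prime power).
record FiniteField (q : ℕ) : Set₁ where
  infixl 6 _+_
  infixl 7 _*_
  field
    Carrier : Set
    _+_ _*_ : Op₂ Carrier
    -_ : Op₁ Carrier
    0# 1# : Carrier
    isCommutativeRing : IsCommutativeRing _≡_ _+_ _*_ -_ 0# 1#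
    0≢1 : ¬ (0# ≡ 1#)
    inverse : ∀ x → ¬ (x ≡ 0#) → ∃ λ y → x * y ≡ 1#
    enumeration : Fin q ↔ Carrier

module _ {q : ℕ} (F : FiniteField q) where
  open FiniteField F

  Vector : ℕ → Set
  Vector n = Fin n → Carrier

  zeroV : ∀ {n} → Vector n
  zeroV _ = 0#

  _+V_ : ∀ {n} → Vector n → Vector n → Vector n
  (u +V v) j = u j + v j

  _·V_ : ∀ {n} → Carrier → Vector n → Vector n
  (c ·V v) j = c * v j

  _≈V_ : ∀ {n} → Vector n → Vector n → Set
  u ≈V v = ∀ j → u j ≡ v j

  record Subspace (n : ℕ) : Set₁ where
    field
      mem : Vector n → Set
      mem-resp : ∀ {u v} → u ≈V v → mem u → mem v
      mem-zero : mem zeroV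
      mem-+ : ∀ {u v} → mem u → mem v → mem (u +V v)
      mem-· : ∀ c {v} → mem v → mem (c ·V v)
  open Subspace public

  _∈S_ : ∀ {n} → Vector n → Subspace n → Set
  v ∈S U = mem U v

  _⊆S_ : ∀ {n} → Subspace n → Subspace n → Set
  U ⊆S W = ∀ v → v ∈S U → v ∈S W

  ΣF : (d : ℕ) → (Fin d → Carrier) → Carrier
  ΣF zero f = 0#
  ΣF (suc d) f = f Fin.zero + ΣF d (λ i → f (Fin.suc i))

  lincomb : ∀ {n d} → (Fin d → Carrier) → (Fin d → Vector n) → Vector n
  lincomb {d = d} c b j = ΣF d (λ i → c i * b i j)

  LinearlyIndependent : ∀ {n d} → (Fin d → Vector n) → Set
  LinearlyIndependent {d = d} b =
    ∀ (c : Fin d → Carrier) → lincomb c b ≈V zeroV → ∀ i → c i ≡ 0#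

  -- U has (algebraic) dimension d: it has a basis of d vectors
  HasDim : ∀ {n} → Subspace n → ℕ → Set
  HasDim {n} U d = Σ (Fin d → Vector n) λ b →
    (∀ i → b i ∈S U) × LinearlyIndependent b ×
    (∀ v → v ∈S U → ∃ λ (c : Fin d → Carrier) → v ≈V lincomb c b)

  -- the point spanned by v≠0 lies in U iff v ∈ U; points outside H∞ are
  -- exactly the spans of vectors v ∉ H∞ (such v are automatically nonzero).
  IsAVSP : ∀ {n r} → (Fin r → Subspace n) → (H : Subspace n) → Set
  IsAVSP {n} {r} U H =
    HasDim H (n ∸ 1) ×
    (∀ i → ∃ λ d → HasDim (U i) d × 1 ≤ d × d ≤ n ∸ 1) ×
    (∀ i → ¬ (U i ⊆S H)) ×
    (∀ v → ¬ (v ∈S H) → ∃ λ i → v ∈S U i × (∀ j → v ∈S U j → j ≡ i))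

  IsAVSPOf : ∀ {n r} → (Fin r → Subspace n) → Subset r → (W H : Subspace n) → Set
  IsAVSPOf {n} {r} U S W H =
    (∀ i → i ∈ S → U i ⊆S W) ×
    (∀ i → i ∈ S → ¬ (U i ⊆S H)) ×
    (∀ v → v ∈S W → ¬ (v ∈S H) →
       ∃ λ i → i ∈ S × v ∈S U i × (∀ j → j ∈ S → v ∈S U j → j ≡ i))

  Reducible : ∀ {n r} → (Fin r → Subspace n) → (H : Subspace n) → Set₁
  Reducible {n} {r} U H =
    Σ (Subspace n) λ W → Σ (Subset r) λ S →
      (∃ λ d → HasDim W d × d < n) ×
      ¬ (W ⊆S H) ×
      1 < ∣ S ∣ × (∃ λ i → i ∉ S) ×
      IsAVSPOf U S W H

  Irreducible : ∀ {n r} → (Fin r → Subspace n) → (H : Subspace n) → Set₁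
  Irreducible U H = ¬ Reducible U H

  Tight : ∀ {n r} → (Fin r → Subspace n) → Set
  Tight {n} {r} U = ∀ (v : Vector n) → (∀ i → v ∈S U i) → v ≈V zeroV

count : ∀ {r} → (Fin r → ℕ) → ℕ → ℕ
count {zero} f k = 0
count {suc r} f k =
  (if does (f Fin.zero ≟ k) then 1 else 0) Data.Nat.+ count (λ i → f (Fin.suc i)) k

-- Fix a hyperplane U₀ of the partition, a point e ∈ U₀ outside H∞ and a point y ∈ H∞ outside
-- U₀.  Two hyperplanes of the partition can only meet inside H∞, which forces every hyperplane
-- of the partition to contain U₀ ∩ H∞ and to meet the affine line e + ⟨y⟩ in exactly one point
-- e − s·y; distinct hyperplanes have distinct slopes s, so m_{n-1} ≤ q.  Every point outside H∞
-- lies in the span of U₀ ∩ H∞ and some e − s·y.  Hence, if all q slopes occur, every part is a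
-- hyperplane, m_{n-1} = q, and the nonzero vectors of U₀ ∩ H∞ lie in all parts.  If exactly one
-- slope s is missed, the remaining parts form an avsp of the proper subspace
-- (U₀ ∩ H∞) + ⟨e − s·y⟩, contradicting irreducibility.  Otherwise two slopes are missed and
-- m_{n-1} ≤ q − 2.
module Submission where

open import Defs
open import Data.Nat using (ℕ; _≤_; _∸_)
open import Data.Fin using (Fin)
open import Data.Sum using (_⊎_)
open import Data.Product using (_×_)
open import Relation.Binary.PropositionalEquality using (_≡_)
open import Relation.Nullary using (¬_)

open import Algebra.Bundles using (CommutativeRing)
open import Algebra.Bundles.Raw using (RawRing)
import Algebra.Properties.AbelianGroup as AbelianGroupProperties
import Algebra.Properties.CommutativeSemigroup as CommutativeSemigroupProperties
import Algebra.Properties.Group as GroupProperties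
import Algebra.Properties.Ring as RingProperties
import Algebra.Properties.Semiring.Mult as SemiringMultiplication
import Algebra.Properties.Semiring.Sum as SemiringSum
import Algebra.Solver.Ring
open import Algebra.Solver.Ring.AlmostCommutativeRing using (fromCommutativeRing; _-Raw-AlmostCommutative⟶_)
open import Data.Bool using (true; false; T)
open import Data.Bool.Properties using (T-≡)
open import Data.Empty using (⊥-elim)
open import Data.Fin using (zero; suc; punchIn; fromℕ<)
import Data.Fin.Properties as Fin
open import Data.Fin.Subset using (Subset; _∈_; ∣_∣)
open import Data.Fin.Subset.Properties using (x∈p∧x≢y⇒x∈p-y; x∈p⇒∣p-x∣<∣p∣)
open import Data.Maybe using (Maybe; just; nothing)
open import Data.Nat as ℕ using ()
import Data.Nat.Properties as ℕ
open import Data.Product using (∃; _,_; proj₁; proj₂)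
open import Data.Sum using (inj₁; inj₂; [_,_]′)
open import Data.Vec using (tabulate)
open import Data.Vec.Functional using (_∷_; insertAt)
open import Data.Vec.Functional.Properties using (insertAt-lookup; insertAt-punchIn)
open import Data.Vec.Properties using (lookup∘tabulate; lookup⇒[]=; []=⇒lookup)
open import Function.Base using (_∘_; id)
open import Function.Bundles using (_↔_; Inverse; Injection; Equivalence)
open import Function.Construct.Identity using (↔-id)
open import Function.Definitions using (Injective)
open import Function.Properties.Inverse using (↔⇒↣; ↔-sym)
open import Level using (0ℓ)
open import Relation.Binary.Definitions using (DecidableEquality)
import Relation.Binary.PropositionalEquality as ≡
open import Relation.Binary.PropositionalEquality
  using (_≢_; ≢-sym; refl; sym; trans; cong; cong₂; subst; module ≡-Reasoning)
open import Relation.Nullary using (Dec; yes; no)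
open import Relation.Nullary.Decidable
  using (via-injection; _⊎-dec_; isNo; fromWitnessFalse; toWitnessFalse)
open import Relation.Nullary.Negation using (contradiction)

-- A ring solver for any commutative ring, with the formal differences a − b of natural numbers
-- as coefficients: the ring itself cannot serve as its own coefficient domain when its elements
-- are abstract, since the solver must decide coefficient equality by computation.
module DifferenceSolver {c ℓ} (R : CommutativeRing c ℓ) where
  open CommutativeRing R hiding (refl; sym; trans)
  open CommutativeRing R using () renaming (sym to ≈-sym; trans to ≈-trans)
  open RingProperties ring using (-‿distribˡ-*; -‿distribʳ-*; -‿involutive; -0#≈0#)
  open AbelianGroupProperties +-abelianGroup using (⁻¹-∙-comm)
  open CommutativeSemigroupProperties +-commutativeSemigroup using (interchange)
  open SemiringMultiplication semiring using (×-homo-+; ×1-homo-*) renaming (_×_ to _times_)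
  open import Relation.Binary.Reasoning.Setoid setoid

  private
    Difference : RawRing _ _
    Difference = record
      { Carrier = ℕ × ℕ
      ; _≈_ = _≡_
      ; _+_ = λ { (a , b) (c , d) → (a ℕ.+ c , b ℕ.+ d) }
      ; _*_ = λ { (a , b) (c , d) → (a ℕ.* c ℕ.+ b ℕ.* d , a ℕ.* d ℕ.+ b ℕ.* c) }
      ; -_ = λ { (a , b) → (b , a) }
      ; 0# = (0 , 0)
      ; 1# = (1 , 0)
      }

    ι : ℕ → Carrier
    ι a = a times 1#

    ⟦_⟧ : ℕ × ℕ → Carrier
    ⟦ a , b ⟧ = ι a - ι b

    ι-+ : ∀ a b → ι (a ℕ.+ b) ≈ ι a + ι b
    ι-+ = ×-homo-+ 1#

    ι-bilinear : ∀ a c b d → ι (a ℕ.* c ℕ.+ b ℕ.* d) ≈ ι a * ι c + ι b * ι d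
    ι-bilinear a c b d = ≈-trans (ι-+ (a ℕ.* c) (b ℕ.* d)) (+-cong (×1-homo-* a c) (×1-homo-* b d))

    -‿+ : ∀ x y → - (x + y) ≈ - x + - y
    -‿+ x y = ≈-sym (⁻¹-∙-comm x y)

    -‿*-‿ : ∀ x y → - x * - y ≈ x * y
    -‿*-‿ x y = ≈-trans (≈-sym (-‿distribˡ-* x (- y)))
                        (≈-trans (-‿cong (≈-sym (-‿distribʳ-* x y))) (-‿involutive _))

    difference-* : ∀ x y z w → (x - y) * (z - w) ≈ (x * z + y * w) - (x * w + y * z)
    difference-* x y z w = begin
      (x - y) * (z - w)                           ≈⟨ distribʳ _ _ _ ⟩
      x * (z - w) + - y * (z - w)                 ≈⟨ +-cong (distribˡ _ _ _) (distribˡ _ _ _) ⟩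
      (x * z + x * - w) + (- y * z + - y * - w)   ≈⟨ +-cong (+-congˡ (≈-sym (-‿distribʳ-* x w)))
                                                           (+-cong (≈-sym (-‿distribˡ-* y z)) (-‿*-‿ y w)) ⟩
      (x * z - x * w) + (- (y * z) + y * w)       ≈⟨ +-congˡ (+-comm _ _) ⟩
      (x * z - x * w) + (y * w - y * z)           ≈⟨ interchange _ _ _ _ ⟩
      (x * z + y * w) + (- (x * w) + - (y * z))   ≈⟨ +-congˡ (≈-sym (-‿+ _ _)) ⟩
      (x * z + y * w) - (x * w + y * z)           ∎

    ⟦⟧-+ : ∀ p r → ⟦ RawRing._+_ Difference p r ⟧ ≈ ⟦ p ⟧ + ⟦ r ⟧
    ⟦⟧-+ (a , b) (c , d) = begin
      ι (a ℕ.+ c) - ι (b ℕ.+ d)        ≈⟨ +-cong (ι-+ a c) (-‿cong (ι-+ b d)) ⟩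
      (ι a + ι c) - (ι b + ι d)        ≈⟨ +-congˡ (-‿+ (ι b) (ι d)) ⟩
      (ι a + ι c) + (- ι b + - ι d)    ≈⟨ interchange _ _ _ _ ⟩
      (ι a - ι b) + (ι c - ι d)        ∎

    ⟦⟧-* : ∀ p r → ⟦ RawRing._*_ Difference p r ⟧ ≈ ⟦ p ⟧ * ⟦ r ⟧
    ⟦⟧-* (a , b) (c , d) = begin
      ι (a ℕ.* c ℕ.+ b ℕ.* d) - ι (a ℕ.* d ℕ.+ b ℕ.* c)
        ≈⟨ +-cong (ι-bilinear a c b d) (-‿cong (ι-bilinear a d b c)) ⟩
      (ι a * ι c + ι b * ι d) - (ι a * ι d + ι b * ι c)
        ≈⟨ ≈-sym (difference-* _ _ _ _) ⟩
      (ι a - ι b) * (ι c - ι d) ∎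

    ⟦⟧-neg : ∀ p → ⟦ RawRing.-_ Difference p ⟧ ≈ - ⟦ p ⟧
    ⟦⟧-neg (a , b) = begin
      ι b - ι a        ≈⟨ +-comm _ _ ⟩
      - ι a + ι b      ≈⟨ +-congˡ (≈-sym (-‿involutive _)) ⟩
      - ι a + - - ι b  ≈⟨ ≈-sym (-‿+ _ _) ⟩
      - (ι a - ι b)    ∎

    morphism : Difference -Raw-AlmostCommutative⟶ fromCommutativeRing R
    morphism = record
      { ⟦_⟧ = ⟦_⟧
      ; +-homo = ⟦⟧-+
      ; *-homo = ⟦⟧-*
      ; -‿homo = ⟦⟧-neg
      ; 0-homo = ≈-trans (+-identityˡ _) -0#≈0#
      ; 1-homo = ≈-trans (+-cong (+-identityʳ 1#) -0#≈0#) (+-identityʳ 1#)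
      }

    balance : ∀ {x y z w} → x + w ≈ z + y → x - y ≈ z - w
    balance {x} {y} {z} {w} x+w≈z+y = begin
      x - y                   ≈⟨ ≈-sym (+-identityʳ _) ⟩
      (x - y) + 0#            ≈⟨ +-congˡ (≈-sym (-‿inverseʳ w)) ⟩
      (x - y) + (w - w)       ≈⟨ interchange _ _ _ _ ⟩
      (x + w) + (- y - w)     ≈⟨ +-cong x+w≈z+y (+-comm _ _) ⟩
      (z + y) + (- w - y)     ≈⟨ interchange _ _ _ _ ⟩
      (z - w) + (y - y)       ≈⟨ +-congˡ (-‿inverseʳ y) ⟩
      (z - w) + 0#            ≈⟨ +-identityʳ _ ⟩
      z - w                   ∎

    _≟⟦⟧_ : ∀ p r → Maybe (⟦ p ⟧ ≈ ⟦ r ⟧)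
    (a , b) ≟⟦⟧ (c , d) with a ℕ.+ d ℕ.≟ c ℕ.+ b
    ... | no _ = nothing
    ... | yes a+d≡c+b = just (balance (begin
      ι a + ι d        ≈⟨ ≈-sym (ι-+ a d) ⟩
      ι (a ℕ.+ d)      ≡⟨ ≡.cong ι a+d≡c+b ⟩
      ι (c ℕ.+ b)      ≈⟨ ι-+ c b ⟩
      ι c + ι b        ∎))

  open Algebra.Solver.Ring Difference (fromCommutativeRing R) morphism _≟⟦⟧_ public

-- Counting

Hits : ∀ {A : Set} {m} → (Fin m → A) → A → Set
Hits f y = ∃ λ x → f x ≡ y

∷-injective : ∀ {A : Set} {m} {f : Fin m → A} {y} →
              Injective _≡_ _≡_ f → ¬ Hits f y → Injective _≡_ _≡_ (y ∷ f)
∷-injective inj miss {zero} {zero} _ = refl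
∷-injective inj miss {zero} {suc j} eq = contradiction (j , sym eq) miss
∷-injective inj miss {suc i} {zero} eq = contradiction (i , eq) miss
∷-injective inj miss {suc i} {suc j} eq = cong suc (inj eq)

module _ {A : Set} {q : ℕ} (enumeration : Fin q ↔ A) where
  private
    _≟_ : DecidableEquality A
    _≟_ = via-injection (↔⇒↣ (↔-sym enumeration)) Fin._≟_

    open Inverse enumeration using (to; from; strictlyInverseˡ)

  ∀-or-counterexample : {P : A → Set} → (∀ y → Dec (P y)) → (∀ y → P y) ⊎ ∃ λ y → ¬ P y
  ∀-or-counterexample {P} P? with Fin.all? (P? ∘ to)
  ... | yes all = inj₁ (λ y → subst P (strictlyInverseˡ y) (all (from y)))
  ... | no ¬all = let i , ¬Pi = Fin.¬∀⟶∃¬ q _ (P? ∘ to) ¬all in inj₂ (to i , ¬Pi)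

  ∃? : {P : A → Set} → (∀ y → Dec (P y)) → Dec (∃ P)
  ∃? {P} P? with Fin.any? (P? ∘ to)
  ... | yes (i , Pi) = yes (to i , Pi)
  ... | no ¬any = no (λ (y , Py) → ¬any (from y , subst P (sym (strictlyInverseˡ y)) Py))

  hits? : ∀ {m} (f : Fin m → A) y → Dec (Hits f y)
  hits? f y = Fin.any? (λ x → f x ≟ y)

  injective⇒≤ : ∀ {m} {f : Fin m → A} → Injective _≡_ _≡_ f → m ℕ.≤ q
  injective⇒≤ f-injective = Fin.injective⇒≤ (f-injective ∘ Injection.injective (↔⇒↣ (↔-sym enumeration)))

  surjective⇒≥ : ∀ {m} (f : Fin m → A) → (∀ y → Hits f y) → q ℕ.≤ m
  surjective⇒≥ f hits = Fin.injective⇒≤ preimage-injective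
    where
    preimage-injective : Injective _≡_ _≡_ (λ i → proj₁ (hits (to i)))
    preimage-injective {i} {i′} eq = Injection.injective (↔⇒↣ enumeration) (begin
      to i                     ≡⟨ sym (proj₂ (hits (to i))) ⟩
      f (proj₁ (hits (to i)))  ≡⟨ cong f eq ⟩
      f (proj₁ (hits (to i′))) ≡⟨ proj₂ (hits (to i′)) ⟩
      to i′                    ∎)
      where open ≡-Reasoning

  module _ {m : ℕ} {f : Fin m → A} (f-injective : Injective _≡_ _≡_ f) where

    missing-two⇒≤∸2 : ∀ {y₁ y₂} → y₂ ≢ y₁ → ¬ Hits f y₁ → ¬ Hits f y₂ → m ℕ.≤ q ℕ.∸ 2
    missing-two⇒≤∸2 {y₁} {y₂} y₂≢y₁ miss₁ miss₂ =
      ℕ.∸-monoˡ-≤ 2 (injective⇒≤ (∷-injective (∷-injective f-injective miss₂) miss₁′))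
      where
      miss₁′ : ¬ Hits (y₂ ∷ f) y₁
      miss₁′ (zero , y₂≡y₁) = y₂≢y₁ y₂≡y₁
      miss₁′ (suc x , fx≡y₁) = miss₁ (x , fx≡y₁)

    image-trichotomy : (∀ y → Hits f y) ⊎
                       (∃ λ y → ¬ Hits f y × ∀ y′ → y′ ≡ y ⊎ Hits f y′) ⊎
                       m ℕ.≤ q ℕ.∸ 2
    image-trichotomy with ∀-or-counterexample (hits? f)
    ... | inj₁ all = inj₁ all
    ... | inj₂ (y₁ , miss₁) with ∀-or-counterexample (λ y → (y ≟ y₁) ⊎-dec hits? f y)
    ...   | inj₁ rest = inj₂ (inj₁ (y₁ , miss₁ , rest))
    ...   | inj₂ (y₂ , neither) = inj₂ (inj₂ (missing-two⇒≤∸2 (neither ∘ inj₁) miss₁ (neither ∘ inj₂)))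

record FiberEnumeration {r : ℕ} (f : Fin r → ℕ) (k m : ℕ) : Set where
  field
    index : Fin m → Fin r
    index-injective : Injective _≡_ _≡_ index
    index-value : ∀ j → f (index j) ≡ k
    index-surjective : ∀ i → f i ≡ k → ∃ λ j → index j ≡ i

-- `count` tests `does (f zero ≟ k)`, which reduces to `f zero ≡ᵇ k`; that is what we split on.
count-fiber : ∀ {r} (f : Fin r → ℕ) k → FiberEnumeration f k (count f k)
count-fiber {ℕ.zero} f k = record
  { index = λ () ; index-injective = λ {} ; index-value = λ () ; index-surjective = λ () }
count-fiber {ℕ.suc r} f k with f zero ℕ.≡ᵇ k in f0≡ᵇk
... | true = record
  { index = zero ∷ (suc ∘ index)
  ; index-injective = ∷-index-injective
  ; index-value = λ { zero → f0≡k ; (suc j) → index-value j }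
  ; index-surjective = λ { zero _ → zero , refl
                         ; (suc i) fi≡k → let j , eq = index-surjective i fi≡k in suc j , cong suc eq }
  }
  where
  open FiberEnumeration (count-fiber (f ∘ suc) k)
  f0≡k : f zero ≡ k
  f0≡k = ℕ.≡ᵇ⇒≡ (f zero) k (subst T (sym f0≡ᵇk) _)
  ∷-index-injective : Injective _≡_ _≡_ (zero ∷ (suc ∘ index))
  ∷-index-injective {zero} {zero} _ = refl
  ∷-index-injective {suc i} {suc j} eq = cong suc (index-injective (Fin.suc-injective eq))
... | false = record
  { index = suc ∘ index
  ; index-injective = index-injective ∘ Fin.suc-injective
  ; index-value = index-value
  ; index-surjective = λ { zero f0≡k → ⊥-elim (subst T f0≡ᵇk (ℕ.≡⇒≡ᵇ (f zero) k f0≡k))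
                         ; (suc i) fi≡k → let j , eq = index-surjective i fi≡k in j , cong suc eq }
  }
  where open FiberEnumeration (count-fiber (f ∘ suc) k)

two-members⇒1<∣∣ : ∀ {r} {p : Subset r} {i j} → i ≢ j → i ∈ p → j ∈ p → 1 ℕ.< ∣ p ∣
two-members⇒1<∣∣ i≢j i∈p j∈p =
  ℕ.≤-<-trans (ℕ.≤-trans (ℕ.s≤s ℕ.z≤n) (x∈p⇒∣p-x∣<∣p∣ j∈p-i)) (x∈p⇒∣p-x∣<∣p∣ i∈p)
  where j∈p-i = x∈p∧x≢y⇒x∈p-y j∈p (≢-sym i≢j)

-- Linear algebra over a finite field

module LinearAlgebra {q : ℕ} (F : FiniteField q) where
  open FiniteField F using (Carrier; 0≢1; inverse; enumeration)

  commutativeRing : CommutativeRing 0ℓ 0ℓ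
  commutativeRing = record { isCommutativeRing = FiniteField.isCommutativeRing F }

  open CommutativeRing commutativeRing
    using (_+_; _*_; -_; _-_; 0#; 1#; +-comm; +-identityˡ; +-identityʳ; *-comm; *-assoc; *-identityˡ;
           zeroˡ; zeroʳ; -‿inverseʳ; semiring; +-group)
  open RingProperties (CommutativeRing.ring commutativeRing) using (-‿distribˡ-*; -0#≈0#; -1*x≈-x)
  open GroupProperties +-group using (x∙y⁻¹≈ε⇒x≈y; inverseˡ-unique)
  open SemiringSum semiring
    using (sum; sum-cong-≗; sum-remove; sum-replicate-zero; ∑-distrib-+; ∑-comm; *-distribˡ-sum; *-distribʳ-sum)
  open DifferenceSolver commutativeRing using (solve; _:+_; _:*_; :-_; _:-_; _:=_)

  infix 4 _≟_
  _≟_ : DecidableEquality Carrier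
  _≟_ = via-injection (↔⇒↣ (↔-sym enumeration)) Fin._≟_

  1≢0 : 1# ≢ 0#
  1≢0 = ≢-sym 0≢1

  inv : (x : Carrier) → x ≢ 0# → Carrier
  inv x x≢0 = proj₁ (inverse x x≢0)

  *-inverseʳ : ∀ {x} (x≢0 : x ≢ 0#) → x * inv x x≢0 ≡ 1#
  *-inverseʳ {x} x≢0 = proj₂ (inverse x x≢0)

  inv-cancelˡ : ∀ {x} (x≢0 : x ≢ 0#) y → inv x x≢0 * (x * y) ≡ y
  inv-cancelˡ {x} x≢0 y = begin
    inv x x≢0 * (x * y)  ≡⟨ sym (*-assoc _ _ _) ⟩
    (inv x x≢0 * x) * y  ≡⟨ cong (_* y) (trans (*-comm _ _) (*-inverseʳ x≢0)) ⟩
    1# * y               ≡⟨ *-identityˡ y ⟩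
    y                    ∎
    where open ≡-Reasoning

  *-≢0 : ∀ {x y} → x ≢ 0# → y ≢ 0# → x * y ≢ 0#
  *-≢0 {x} {y} x≢0 y≢0 xy≡0 =
    y≢0 (trans (sym (inv-cancelˡ x≢0 y)) (trans (cong (inv x x≢0 *_) xy≡0) (zeroʳ _)))

  zero-*-+ : ∀ {t} x y → t ≡ 0# → t * x + y ≡ y
  zero-*-+ x y refl = trans (cong (_+ y) (zeroˡ x)) (+-identityˡ y)

  V : ℕ → Set
  V = Vector F

  infixl 6 _⊕_
  infixr 7 _⊙_
  infix 4 _≋_ _∈ˢ_ _⊆ˢ_

  _⊕_ : ∀ {n} → V n → V n → V n
  _⊕_ = _+V_ F

  _⊙_ : ∀ {n} → Carrier → V n → V n
  _⊙_ = _·V_ F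

  _≋_ : ∀ {n} → V n → V n → Set
  _≋_ = _≈V_ F

  𝟎 : ∀ {n} → V n
  𝟎 = zeroV F

  _∈ˢ_ : ∀ {n} → V n → Subspace F n → Set
  _∈ˢ_ = _∈S_ F

  _⊆ˢ_ : ∀ {n} → Subspace F n → Subspace F n → Set
  _⊆ˢ_ = _⊆S_ F

  lc : ∀ {n d} → (Fin d → Carrier) → (Fin d → V n) → V n
  lc = lincomb F

  ≋-sym : ∀ {n} {u v : V n} → u ≋ v → v ≋ u
  ≋-sym u≋v j = sym (u≋v j)

  _≋?_ : ∀ {n} (u v : V n) → Dec (u ≋ v)
  u ≋? v = Fin.all? (λ j → u j ≟ v j)

  ⊕-comm : ∀ {n} (u v : V n) → u ⊕ v ≋ v ⊕ u
  ⊕-comm u v j = +-comm (u j) (v j)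

  lc-sum : ∀ {n d} (c : Fin d → Carrier) (b : Fin d → V n) x → lc c b x ≡ sum (λ i → c i * b i x)
  lc-sum {d = d} c b x = ΣF≡sum d _
    where
    ΣF≡sum : ∀ d (f : Fin d → Carrier) → ΣF F d f ≡ sum f
    ΣF≡sum ℕ.zero f = refl
    ΣF≡sum (ℕ.suc d) f = cong (f zero +_) (ΣF≡sum d (f ∘ suc))

  sum-≗0 : ∀ {d} {f : Fin d → Carrier} → (∀ i → f i ≡ 0#) → sum f ≡ 0#
  sum-≗0 {d} f≗0 = trans (sum-cong-≗ f≗0) (sum-replicate-zero d)

  lc-congˡ : ∀ {n d} {c c′ : Fin d → Carrier} (b : Fin d → V n) → (∀ i → c i ≡ c′ i) → lc c b ≋ lc c′ b
  lc-congˡ {c = c} {c′} b c≗c′ x =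
    trans (lc-sum c b x) (trans (sum-cong-≗ (λ i → cong (_* b i x) (c≗c′ i))) (sym (lc-sum c′ b x)))

  lc-congʳ : ∀ {n d} (c : Fin d → Carrier) {b b′ : Fin d → V n} → (∀ i → b i ≋ b′ i) → lc c b ≋ lc c b′
  lc-congʳ c {b} {b′} b≋b′ x =
    trans (lc-sum c b x) (trans (sum-cong-≗ (λ i → cong (c i *_) (b≋b′ i x))) (sym (lc-sum c b′ x)))

  lc-assoc : ∀ {n d e} (a : Fin d → Carrier) (C : Fin d → Fin e → Carrier) (c : Fin e → V n) →
             lc a (λ i → lc (C i) c) ≋ lc (lc a C) c
  lc-assoc a C c x = begin
    lc a (λ i → lc (C i) c) x
      ≡⟨ lc-sum a (λ i → lc (C i) c) x ⟩
    sum (λ i → a i * lc (C i) c x)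
      ≡⟨ sum-cong-≗ (λ i → cong (a i *_) (lc-sum (C i) c x)) ⟩
    sum (λ i → a i * sum (λ j → C i j * c j x))
      ≡⟨ sum-cong-≗ (λ i → *-distribˡ-sum (a i) (λ j → C i j * c j x)) ⟩
    sum (λ i → sum (λ j → a i * (C i j * c j x)))
      ≡⟨ ∑-comm (λ i j → a i * (C i j * c j x)) ⟩
    sum (λ j → sum (λ i → a i * (C i j * c j x)))
      ≡⟨ sum-cong-≗ (λ j → sum-cong-≗ (λ i → sym (*-assoc (a i) (C i j) (c j x)))) ⟩
    sum (λ j → sum (λ i → (a i * C i j) * c j x))
      ≡⟨ sum-cong-≗ (λ j → sym (*-distribʳ-sum (c j x) (λ i → a i * C i j))) ⟩
    sum (λ j → sum (λ i → a i * C i j) * c j x)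
      ≡⟨ sum-cong-≗ (λ j → cong (_* c j x) (sym (lc-sum a C j))) ⟩
    sum (λ j → lc a C j * c j x)
      ≡⟨ sym (lc-sum (lc a C) c x) ⟩
    lc (lc a C) c x ∎
    where open ≡-Reasoning

  lc-shift : ∀ {n d} (c α : Fin d → Carrier) (b : Fin d → V n) (y : V n) →
             lc c (λ k → b k ⊕ α k ⊙ y) ≋ lc c b ⊕ sum (λ k → c k * α k) ⊙ y
  lc-shift c α b y x = begin
    lc c (λ k → b k ⊕ α k ⊙ y) x
      ≡⟨ lc-sum c (λ k → b k ⊕ α k ⊙ y) x ⟩
    sum (λ k → c k * (b k x + α k * y x))
      ≡⟨ sum-cong-≗ (λ k → distrib (c k) (b k x) (α k) (y x)) ⟩
    sum (λ k → c k * b k x + (c k * α k) * y x)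
      ≡⟨ ∑-distrib-+ (λ k → c k * b k x) (λ k → (c k * α k) * y x) ⟩
    sum (λ k → c k * b k x) + sum (λ k → (c k * α k) * y x)
      ≡⟨ cong₂ _+_ (sym (lc-sum c b x)) (sym (*-distribʳ-sum (y x) (λ k → c k * α k))) ⟩
    lc c b x + sum (λ k → c k * α k) * y x ∎
    where
    open ≡-Reasoning
    distrib : ∀ c b α y → c * (b + α * y) ≡ c * b + (c * α) * y
    distrib = solve 4 (λ c b α y → c :* (b :+ α :* y) := c :* b :+ (c :* α) :* y) refl

  module _ {n} (X : Subspace F n) where

    ∈-resp : ∀ {u v} → u ∈ˢ X → u ≋ v → v ∈ˢ X
    ∈-resp u∈X u≋v = mem-resp X u≋v u∈X

    ∈-lincomb : ∀ {d} c (b : Fin d → V n) → (∀ i → b i ∈ˢ X) → lc c b ∈ˢ X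
    ∈-lincomb {ℕ.zero} c b b∈X = mem-zero X
    ∈-lincomb {ℕ.suc d} c b b∈X =
      mem-+ X (mem-· X (c zero) (b∈X zero)) (∈-lincomb (c ∘ suc) (b ∘ suc) (b∈X ∘ suc))

    ∈-neg : ∀ {u} → u ∈ˢ X → (λ j → - u j) ∈ˢ X
    ∈-neg u∈X = ∈-resp (mem-· X (- 1#) u∈X) (λ j → -1*x≈-x _)

    ∈-unscale : ∀ {c v} → c ≢ 0# → c ⊙ v ∈ˢ X → v ∈ˢ X
    ∈-unscale {c} c≢0 cv∈X = ∈-resp (mem-· X (inv c c≢0) cv∈X) (λ j → inv-cancelˡ c≢0 _)

    ∉-⊙ : ∀ {t e} → t ≢ 0# → ¬ e ∈ˢ X → ¬ t ⊙ e ∈ˢ X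
    ∉-⊙ t≢0 e∉X te∈X = e∉X (∈-unscale t≢0 te∈X)

    ∉-⊕ : ∀ {k e} → k ∈ˢ X → ¬ e ∈ˢ X → ¬ k ⊕ e ∈ˢ X
    ∉-⊕ {k} {e} k∈X e∉X k+e∈X = e∉X (∈-resp (mem-+ X k+e∈X (∈-neg k∈X)) (λ j → cancel (k j) (e j)))
      where
      cancel : ∀ k e → (k + e) + - k ≡ e
      cancel = solve 2 (λ k e → (k :+ e) :+ :- k := e) refl

    direct-sum-zero : ∀ {u y t} → u ∈ˢ X → ¬ y ∈ˢ X → (∀ j → t * y j + u j ≡ 0#) → t ≡ 0# × u ≋ 𝟎
    direct-sum-zero {u} {y} {t} u∈X y∉X ty+u≡0 with t ≟ 0#
    ... | yes t≡0 = t≡0 , λ j → trans (sym (zero-*-+ (y j) (u j) t≡0)) (ty+u≡0 j)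
    ... | no t≢0 =
      contradiction (∈-resp (∈-neg u∈X) (λ j → sym (inverseˡ-unique _ _ (ty+u≡0 j)))) (∉-⊙ t≢0 y∉X)

  _∩ˢ_ : ∀ {n} → Subspace F n → Subspace F n → Subspace F n
  X ∩ˢ Y = record
    { mem = λ v → v ∈ˢ X × v ∈ˢ Y
    ; mem-resp = λ u≋v (u∈X , u∈Y) → mem-resp X u≋v u∈X , mem-resp Y u≋v u∈Y
    ; mem-zero = mem-zero X , mem-zero Y
    ; mem-+ = λ (u∈X , u∈Y) (v∈X , v∈Y) → mem-+ X u∈X v∈X , mem-+ Y u∈Y v∈Y
    ; mem-· = λ c (v∈X , v∈Y) → mem-· X c v∈X , mem-· Y c v∈Y
    }

  _+⟨_⟩ : ∀ {n} → Subspace F n → V n → Subspace F n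
  X +⟨ z ⟩ = record
    { mem = λ v → ∃ λ a → v ⊕ (- a) ⊙ z ∈ˢ X
    ; mem-resp = λ u≋v (a , u-az∈X) → a , ∈-resp X u-az∈X (λ j → cong (_+ (- a) * z j) (u≋v j))
    ; mem-zero = 0# , ∈-resp X (mem-zero X) (λ j → sym (0-0z j))
    ; mem-+ = λ (a , u-az∈X) (b , v-bz∈X) →
                a + b , ∈-resp X (mem-+ X u-az∈X v-bz∈X) (λ j → split-+ _ _ a b (z j))
    ; mem-· = λ c (a , v-az∈X) → c * a , ∈-resp X (mem-· X c v-az∈X) (λ j → split-* c _ a (z j))
    }
    where
    0-0z : ∀ j → 0# + (- 0#) * z j ≡ 0#
    0-0z j = trans (+-identityˡ _) (trans (sym (-‿distribˡ-* 0# (z j))) (trans (cong -_ (zeroˡ _)) -0#≈0#))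
    split-+ : ∀ u v a b z → (u + (- a) * z) + (v + (- b) * z) ≡ (u + v) + (- (a + b)) * z
    split-+ = solve 5 (λ u v a b z → (u :+ (:- a) :* z) :+ (v :+ (:- b) :* z) := (u :+ v) :+ (:- (a :+ b)) :* z) refl
    split-* : ∀ c v a z → c * (v + (- a) * z) ≡ c * v + (- (c * a)) * z
    split-* = solve 4 (λ c v a z → c :* (v :+ (:- a) :* z) := c :* v :+ (:- (c :* a)) :* z) refl

  module _ {n} (X : Subspace F n) (z : V n) where

    ⊆-+⟨⟩ : X ⊆ˢ X +⟨ z ⟩
    ⊆-+⟨⟩ v v∈X = 0# , ∈-resp X v∈X (λ j → sym (trans (cong (v j +_) (trans (cong (_* z j) -0#≈0#) (zeroˡ _)))
                                                          (+-identityʳ _)))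

    ∈-+⟨⟩ : z ∈ˢ X +⟨ z ⟩
    ∈-+⟨⟩ = 1# , ∈-resp X (mem-zero X) (λ j → sym (trans (cong (z j +_) (-1*x≈-x _)) (-‿inverseʳ _)))

    +⟨⟩-⊆ : ∀ {Y} → X ⊆ˢ Y → z ∈ˢ Y → X +⟨ z ⟩ ⊆ˢ Y
    +⟨⟩-⊆ {Y} X⊆Y z∈Y v (a , v-az∈X) =
      ∈-resp Y (mem-+ Y (X⊆Y _ v-az∈X) (mem-· Y a z∈Y)) (λ j → restore (v j) a (z j))
      where
      restore : ∀ v a z → (v + (- a) * z) + a * z ≡ v
      restore = solve 3 (λ v a z → (v :+ (:- a) :* z) :+ a :* z := v) refl

  module _ {n} (X : Subspace F n) where

    +⟨⟩-unique : ∀ {v y a b} → ¬ y ∈ˢ X → v ⊕ (- a) ⊙ y ∈ˢ X → v ⊕ (- b) ⊙ y ∈ˢ X → a ≡ b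
    +⟨⟩-unique {v} {y} {a} {b} y∉X v-ay∈X v-by∈X with b - a ≟ 0#
    ... | yes b-a≡0 = sym (x∙y⁻¹≈ε⇒x≈y b a b-a≡0)
    ... | no b-a≢0 = contradiction (∈-resp X (mem-+ X v-ay∈X (∈-neg X v-by∈X)) (λ j → difference (v j) a b (y j)))
                                   (∉-⊙ X b-a≢0 y∉X)
      where
      difference : ∀ v a b y → (v + (- a) * y) + - (v + (- b) * y) ≡ (b - a) * y
      difference = solve 4 (λ v a b y → (v :+ (:- a) :* y) :+ :- (v :+ (:- b) :* y) := (b :- a) :* y) refl

    +⟨⟩-cancel : ∀ {v z a} → v ∈ˢ X → v ⊕ (- a) ⊙ z ∈ˢ X → a ≢ 0# → z ∈ˢ X
    +⟨⟩-cancel {v} {z} {a} v∈X v-az∈X a≢0 =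
      ∈-unscale X a≢0 (∈-resp X (mem-+ X v∈X (∈-neg X v-az∈X)) (λ j → difference (v j) a (z j)))
      where
      difference : ∀ v a z → v + - (v + (- a) * z) ≡ a * z
      difference = solve 3 (λ v a z → v :+ :- (v :+ (:- a) :* z) := a :* z) refl

  module _ {n} {H : Subspace F n} (H? : ∀ v → Dec (v ∈ˢ H)) where

    affine-part-⊆ : ∀ {X W : Subspace F n} {a} → a ∈ˢ X → ¬ a ∈ˢ H →
                    (∀ v → v ∈ˢ X → ¬ v ∈ˢ H → v ∈ˢ W) → X ⊆ˢ W
    affine-part-⊆ {X} {W} {a} a∈X a∉H outside⊆W v v∈X with H? v
    ... | no v∉H = outside⊆W v v∈X v∉H
    ... | yes v∈H = ∈-resp W (mem-+ W (outside⊆W (v ⊕ a) (mem-+ X v∈X a∈X) (∉-⊕ H v∈H a∉H))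
                                      (∈-neg W (outside⊆W a a∈X a∉H)))
                             (λ j → cancel (v j) (a j))
      where
      cancel : ∀ v a → (v + a) + - a ≡ v
      cancel = solve 2 (λ v a → (v :+ a) :+ :- a := v) refl

    outside-both : ∀ {W Y : Subspace F n} {z w} → z ∈ˢ W → z ∈ˢ Y → ¬ z ∈ˢ H →
                   w ∈ˢ W → ¬ w ∈ˢ Y → ∃ λ v → v ∈ˢ W × ¬ v ∈ˢ H × ¬ v ∈ˢ Y
    outside-both {W} {Y} {z} {w} z∈W z∈Y z∉H w∈W w∉Y with H? w
    ... | no w∉H = w , w∈W , w∉H , w∉Y
    ... | yes w∈H = w ⊕ z , mem-+ W w∈W z∈W , ∉-⊕ H w∈H z∉H ,
                    λ w+z∈Y → ∉-⊕ Y z∈Y w∉Y (∈-resp Y w+z∈Y (⊕-comm w z))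

  Dependent : ∀ {n k} → (Fin k → V n) → Set
  Dependent b = ∃ λ c → (∃ λ i → c i ≢ 0#) × lc c b ≋ 𝟎

  -- Gaussian elimination of the first coordinate against the pivot vector b p, by
  -- cross-multiplication so that no division is needed.
  module Elimination {n k} (b : Fin (ℕ.suc k) → V (ℕ.suc n)) (p : Fin (ℕ.suc k)) where

    β : Carrier
    β = b p zero

    rest : Fin k → V (ℕ.suc n)
    rest j = b (punchIn p j)

    eliminate : Fin k → V (ℕ.suc n)
    eliminate j x = β * rest j x - rest j zero * b p x

    eliminate-head : ∀ j → eliminate j zero ≡ 0#
    eliminate-head j = trans (cong (_- rest j zero * β) (*-comm _ _)) (-‿inverseʳ _)

    lift : (Fin k → Carrier) → Fin (ℕ.suc k) → Carrier
    lift c = insertAt (λ j → c j * β) p (sum (λ j → - (c j * rest j zero)))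

    lc-lift : ∀ c x → lc (lift c) b x ≡ lc c eliminate x
    lc-lift c x = begin
      lc (lift c) b x                                            ≡⟨ lc-sum (lift c) b x ⟩
      sum (λ i → lift c i * b i x)                               ≡⟨ sum-remove {i = p} (λ i → lift c i * b i x) ⟩
      lift c p * b p x + sum (λ j → lift c (punchIn p j) * rest j x)
        ≡⟨ cong₂ _+_ (cong (_* b p x) (insertAt-lookup _ p _))
                     (sum-cong-≗ (λ j → cong (_* rest j x) (insertAt-punchIn _ p _ j))) ⟩
      sum P * b p x + sum Q                                      ≡⟨ cong (_+ sum Q) (*-distribʳ-sum (b p x) P) ⟩
      sum (λ j → P j * b p x) + sum Q                            ≡⟨ sym (∑-distrib-+ (λ j → P j * b p x) Q) ⟩
      sum (λ j → P j * b p x + Q j)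
        ≡⟨ sum-cong-≗ (λ j → regroup (c j) β (rest j x) (rest j zero) (b p x)) ⟩
      sum (λ j → c j * eliminate j x)                            ≡⟨ sym (lc-sum c eliminate x) ⟩
      lc c eliminate x                                           ∎
      where
      open ≡-Reasoning
      P Q : Fin k → Carrier
      P j = - (c j * rest j zero)
      Q j = (c j * β) * rest j x
      regroup : ∀ c β y α z → - (c * α) * z + (c * β) * y ≡ c * (β * y - α * z)
      regroup = solve 5 (λ c β y α z → :- (c :* α) :* z :+ (c :* β) :* y := c :* (β :* y :- α :* z)) refl

  -- Opaque: only the existence of the witness matters, and unfolding it makes with-abstraction
  -- and unification further down prohibitively expensive.
  opaque
    more-vectors⇒dependent : ∀ n {k} → n ℕ.< k → (b : Fin k → V n) → Dependent b
    more-vectors⇒dependent ℕ.zero {ℕ.suc k} _ b = (λ _ → 1#) , (zero , 1≢0) , λ ()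
    more-vectors⇒dependent (ℕ.suc n) {ℕ.suc k} (ℕ.s≤s n<k) b
      with ∀-or-counterexample (↔-id _) (λ p → b p zero ≟ 0#)
    ... | inj₁ head≡0 =
      let c , nonzero , tails = more-vectors⇒dependent n (ℕ.m<n⇒m<1+n n<k) (λ i → b i ∘ suc)
      in c , nonzero , λ { zero → trans (lc-sum c b zero) (sum-≗0 (λ i → trans (cong (c i *_) (head≡0 i)) (zeroʳ _)))
                         ; (suc x) → tails x }
    ... | inj₂ (p , β≢0) =
      let c , (j , cj≢0) , tails = more-vectors⇒dependent n n<k (λ j → eliminate j ∘ suc)
      in lift c , (punchIn p j , subst (_≢ 0#) (sym (insertAt-punchIn _ p _ j)) (*-≢0 cj≢0 β≢0)) ,
         λ x → trans (lc-lift c x) (eliminated-zero c tails x)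
      where
      open Elimination b p
      eliminated-zero : ∀ c → (∀ x → lc c eliminate (suc x) ≡ 0#) → ∀ x → lc c eliminate x ≡ 0#
      eliminated-zero c tails zero =
        trans (lc-sum c eliminate zero) (sum-≗0 (λ j → trans (cong (c j *_) (eliminate-head j)) (zeroʳ _)))
      eliminated-zero c tails (suc x) = tails x

  module _ {n} {X : Subspace F n} where

    independent-∷ : ∀ {d} {b : Fin d → V n} {e} →
                    (∀ i → b i ∈ˢ X) → LinearlyIndependent F b → ¬ e ∈ˢ X → LinearlyIndependent F (e ∷ b)
    independent-∷ {b = b} b∈X b-indep e∉X c c·e∷b≋0 = λ where
        zero → proj₁ split
        (suc i) → b-indep (c ∘ suc) (proj₂ split) i
      where split = direct-sum-zero X (∈-lincomb X (c ∘ suc) b b∈X) e∉X c·e∷b≋0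

    independent-shift : ∀ {d} {b : Fin d → V n} {y} →
                        (∀ i → b i ∈ˢ X) → LinearlyIndependent F b → ¬ y ∈ˢ X →
                        ∀ α → LinearlyIndependent F (λ k → b k ⊕ α k ⊙ y)
    independent-shift {b = b} {y} b∈X b-indep y∉X α c c·shift≋0 =
      b-indep c (proj₂ (direct-sum-zero X (∈-lincomb X c b b∈X) y∉X
        (λ j → trans (+-comm _ _) (trans (sym (lc-shift c α b y j)) (c·shift≋0 j)))))

  independent⇒≤ : ∀ {n d e} {b : Fin d → V n} (c : Fin e → V n) → LinearlyIndependent F b →
                  (∀ i → ∃ λ C → b i ≋ lc C c) → d ℕ.≤ e
  independent⇒≤ {d = d} {e} {b} c b-indep spanned with d ℕ.≤? e
  ... | yes d≤e = d≤e
  ... | no d≰e =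
    let a , (i , ai≢0) , aC≋0 = more-vectors⇒dependent e (ℕ.≰⇒> d≰e) C
    in contradiction (b-indep a (ab≋0 a aC≋0) i) ai≢0
    where
    C : Fin d → Fin e → Carrier
    C = proj₁ ∘ spanned
    ab≋0 : ∀ a → lc a C ≋ 𝟎 → lc a b ≋ 𝟎
    ab≋0 a aC≋0 x = begin
      lc a b x                   ≡⟨ lc-congʳ a (proj₂ ∘ spanned) x ⟩
      lc a (λ i → lc (C i) c) x  ≡⟨ lc-assoc a C c x ⟩
      lc (lc a C) c x            ≡⟨ lc-congˡ c aC≋0 x ⟩
      lc (λ _ → 0#) c x          ≡⟨ trans (lc-sum _ c x) (sum-≗0 (λ j → zeroˡ (c j x))) ⟩
      0#                         ∎
      where open ≡-Reasoning

  module _ {n a b} {X Y : Subspace F n} (dimX : HasDim F X a) (dimY : HasDim F Y b) (X⊆Y : X ⊆ˢ Y) where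
    private
      basisY = proj₁ dimY
      spansY = proj₂ (proj₂ (proj₂ dimY))
      basisX∈⟨basisY⟩ : ∀ i → ∃ λ C → proj₁ dimX i ≋ lc C basisY
      basisX∈⟨basisY⟩ i = spansY _ (X⊆Y _ (proj₁ (proj₂ dimX) i))

    ⊆⇒dim≤ : a ℕ.≤ b
    ⊆⇒dim≤ = independent⇒≤ basisY (proj₁ (proj₂ (proj₂ dimX))) basisX∈⟨basisY⟩

    ⊂⇒dim< : ∀ {v} → v ∈ˢ Y → ¬ v ∈ˢ X → a ℕ.< b
    ⊂⇒dim< {v} v∈Y v∉X =
      independent⇒≤ {b = v ∷ proj₁ dimX} basisY
        (independent-∷ {X = X} (proj₁ (proj₂ dimX)) (proj₁ (proj₂ (proj₂ dimX))) v∉X)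
        λ { zero → spansY v v∈Y ; (suc i) → basisX∈⟨basisY⟩ i }

  coefficients? : ∀ d {P : (Fin d → Carrier) → Set} →
                  (∀ {c c′} → (∀ i → c i ≡ c′ i) → P c → P c′) → (∀ c → Dec (P c)) → Dec (∃ P)
  coefficients? ℕ.zero {P} P-resp P? with P? (λ ())
  ... | yes P∅ = yes (_ , P∅)
  ... | no ¬P∅ = no (λ (c , Pc) → ¬P∅ (P-resp (λ ()) Pc))
  coefficients? (ℕ.suc d) {P} P-resp P?
    with ∃? enumeration (λ a → coefficients? d (λ c≗c′ → P-resp (λ { zero → refl ; (suc i) → c≗c′ i }))
                                               (P? ∘ (a ∷_)))
  ... | yes (a , c , Pac) = yes (a ∷ c , Pac)
  ... | no ¬P = no (λ (c , Pc) → ¬P (c zero , c ∘ suc , P-resp (λ { zero → refl ; (suc i) → refl }) Pc))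

  ∈? : ∀ {n d} {X : Subspace F n} → HasDim F X d → ∀ v → Dec (v ∈ˢ X)
  ∈? {d = d} {X} (b , b∈X , _ , spans) v
    with coefficients? d (λ c≗c′ v≋cb x → trans (v≋cb x) (lc-congˡ b c≗c′ x)) (λ c → v ≋? lc c b)
  ... | yes (c , v≋cb) = yes (∈-resp X (∈-lincomb X c b b∈X) (≋-sym v≋cb))
  ... | no ¬spanned = no (¬spanned ∘ spans v)

  ⊆-or-∉ : ∀ {n d} {X Y : Subspace F n} → HasDim F X d → (∀ v → Dec (v ∈ˢ Y)) →
           X ⊆ˢ Y ⊎ ∃ λ v → v ∈ˢ X × ¬ v ∈ˢ Y
  ⊆-or-∉ {Y = Y} (b , b∈X , _ , spans) Y? with ∀-or-counterexample (↔-id _) (Y? ∘ b)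
  ... | inj₁ b∈Y = inj₁ (λ v v∈X → let c , v≋cb = spans v v∈X
                                  in ∈-resp Y (∈-lincomb Y c b b∈Y) (≋-sym v≋cb))
  ... | inj₂ (i , bi∉Y) = inj₂ (b i , b∈X i , bi∉Y)

  opaque
    hyperplane-+⟨⟩ : ∀ {d} {X : Subspace F (ℕ.suc d)} {x} →
                     HasDim F X d → ¬ x ∈ˢ X → ∀ w → w ∈ˢ X +⟨ x ⟩
    hyperplane-+⟨⟩ {d} {X} {x} (b , b∈X , b-indep , _) x∉X w =
      let c , (_ , ci≢0) , c≋0 = more-vectors⇒dependent (ℕ.suc d) (ℕ.n<1+n _) (w ∷ x ∷ b)
      in from-dependency c ci≢0 c≋0 (c zero ≟ 0#)
      where
      from-dependency : ∀ c {i} → c i ≢ 0# → lc c (w ∷ x ∷ b) ≋ 𝟎 → Dec (c zero ≡ 0#) →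
                        w ∈ˢ X +⟨ x ⟩
      from-dependency c _ c≋0 (no c0≢0) =
        ∈-unscale (X +⟨ x ⟩) c0≢0
          (∈-resp (X +⟨ x ⟩) (∈-neg (X +⟨ x ⟩) c1x+r∈) (λ j → sym (inverseˡ-unique _ _ (c≋0 j))))
        where
        c1x+r∈ : (c (suc zero) ⊙ x ⊕ lc (c ∘ suc ∘ suc) b) ∈ˢ X +⟨ x ⟩
        c1x+r∈ = mem-+ (X +⟨ x ⟩) (mem-· (X +⟨ x ⟩) (c (suc zero)) (∈-+⟨⟩ X x))
                                  (⊆-+⟨⟩ X x _ (∈-lincomb X (c ∘ suc ∘ suc) b b∈X))
      from-dependency c {i} ci≢0 c≋0 (yes c0≡0) = contradiction (all-zero i) ci≢0
        where
        split : c (suc zero) ≡ 0# × lc (c ∘ suc ∘ suc) b ≋ 𝟎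
        split = direct-sum-zero X (∈-lincomb X (c ∘ suc ∘ suc) b b∈X) x∉X
                  (λ j → trans (sym (zero-*-+ (w j) _ c0≡0)) (c≋0 j))
        all-zero : ∀ i → c i ≡ 0#
        all-zero zero = c0≡0
        all-zero (suc zero) = proj₁ split
        all-zero (suc (suc i)) = b-indep _ (proj₂ split) i

-- Affine vector space partitions

module AffinePartition {q : ℕ} (F : FiniteField q) {d r : ℕ}
  (U : Fin r → Subspace F (ℕ.suc d)) (H : Subspace F (ℕ.suc d))
  (dims : Fin r → ℕ) (dimU : ∀ i → HasDim F (U i) (dims i)) (avsp : IsAVSP F U H) where

  open LinearAlgebra F
  open FiniteField F using (Carrier; enumeration)
  open CommutativeRing commutativeRing
    using (_+_; _*_; -_; 0#; +-comm; *-assoc; *-identityˡ; +-identityʳ; +-group)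
  open RingProperties (CommutativeRing.ring commutativeRing) using (-0#≈0#)
  open GroupProperties +-group using (inverseˡ-unique)
  open SemiringSum (CommutativeRing.semiring commutativeRing) using (sum; sum-cong-≗; *-distribʳ-sum)
  open DifferenceSolver commutativeRing using (solve; _:+_; _:*_; :-_; _:=_)

  dimH : HasDim F H d
  dimH = proj₁ avsp

  H? : ∀ v → Dec (v ∈ˢ H)
  H? = ∈? {X = H} dimH

  opaque
    affine-point : ∀ i → ∃ λ v → v ∈ˢ U i × ¬ v ∈ˢ H
    affine-point i with ⊆-or-∉ {X = U i} {Y = H} (dimU i) H?
    ... | inj₁ Ui⊆H = contradiction Ui⊆H (proj₁ (proj₂ (proj₂ avsp)) i)
    ... | inj₂ v = v

  part : ∀ v → ¬ v ∈ˢ H → Fin r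
  part v v∉H = proj₁ (proj₂ (proj₂ (proj₂ avsp)) v v∉H)

  ∈-part : ∀ v (v∉H : ¬ v ∈ˢ H) → v ∈ˢ U (part v v∉H)
  ∈-part v v∉H = proj₁ (proj₂ (proj₂ (proj₂ (proj₂ avsp)) v v∉H))

  part-unique : ∀ {v i j} → ¬ v ∈ˢ H → v ∈ˢ U i → v ∈ˢ U j → i ≡ j
  part-unique {v} v∉H v∈Ui v∈Uj = trans (unique _ v∈Ui) (sym (unique _ v∈Uj))
    where unique = proj₂ (proj₂ (proj₂ (proj₂ (proj₂ avsp)) v v∉H))

  Hyperplane : Fin r → Set
  Hyperplane i = dims i ≡ d

  dimHyperplane : ∀ {j} → Hyperplane j → HasDim F (U j) d
  dimHyperplane {j} hyp-j = subst (HasDim F (U j)) hyp-j (dimU j)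

  -- An affine point a of U i (i ≠ j) is not in the hyperplane U j, so k − s·a ∈ U j for some s;
  -- if s ≠ 0 this would be a point of U i ∩ U j outside H∞.
  ∩H⊆hyperplane : ∀ {i j} → Hyperplane j → U i ∩ˢ H ⊆ˢ U j
  ∩H⊆hyperplane {i} {j} hyp-j k (k∈Ui , k∈H) with i Fin.≟ j
  ... | yes refl = k∈Ui
  ... | no i≢j = let s , k-sa∈Uj = hyperplane-+⟨⟩ {X = U j} (dimHyperplane hyp-j) a∉Uj k in k∈Uj s k-sa∈Uj
    where
    a = proj₁ (affine-point i)
    a∈Ui = proj₁ (proj₂ (affine-point i))
    a∉H = proj₂ (proj₂ (affine-point i))
    a∉Uj : ¬ a ∈ˢ U j
    a∉Uj a∈Uj = i≢j (part-unique a∉H a∈Ui a∈Uj)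
    k∈Uj : ∀ s → k ⊕ (- s) ⊙ a ∈ˢ U j → k ∈ˢ U j
    k∈Uj s k-sa∈Uj with - s ≟ 0#
    ... | yes -s≡0 = ∈-resp (U j) k-sa∈Uj (λ x → trans (+-comm _ _) (zero-*-+ _ _ -s≡0))
    ... | no -s≢0 = contradiction (part-unique (∉-⊕ H k∈H (∉-⊙ H -s≢0 a∉H))
                                               (mem-+ (U i) k∈Ui (mem-· (U i) (- s) a∈Ui)) k-sa∈Uj) i≢j

  nonHyperplanes : Subset r
  nonHyperplanes = tabulate (λ i → isNo (dims i ℕ.≟ d))

  ∈nonHyperplanes⁺ : ∀ {i} → ¬ Hyperplane i → i ∈ nonHyperplanes
  ∈nonHyperplanes⁺ {i} ¬hyp = lookup⇒[]= i nonHyperplanes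
    (trans (lookup∘tabulate _ i) (Equivalence.to T-≡ (fromWitnessFalse ¬hyp)))

  ∈nonHyperplanes⁻ : ∀ {i} → i ∈ nonHyperplanes → ¬ Hyperplane i
  ∈nonHyperplanes⁻ {i} i∈S = toWitnessFalse
    (Equivalence.from T-≡ (trans (sym (lookup∘tabulate _ i)) ([]=⇒lookup i∈S)))

  m : ℕ
  m = count dims d

  open FiberEnumeration (count-fiber dims d)
    renaming (index to hyperplane; index-injective to hyperplane-injective;
              index-value to hyperplane-is; index-surjective to hyperplane-surjective)

  module Pencil (j₀ : Fin m) where

    U₀ : Subspace F (ℕ.suc d)
    U₀ = U (hyperplane j₀)

    dimU₀ : HasDim F U₀ d
    dimU₀ = dimHyperplane (hyperplane-is j₀)

    e : V (ℕ.suc d)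
    e = proj₁ (affine-point (hyperplane j₀))

    e∈U₀ : e ∈ˢ U₀
    e∈U₀ = proj₁ (proj₂ (affine-point (hyperplane j₀)))

    e∉H : ¬ e ∈ˢ H
    e∉H = proj₂ (proj₂ (affine-point (hyperplane j₀)))

    H⊈U₀ : ∃ λ y → y ∈ˢ H × ¬ y ∈ˢ U₀
    H⊈U₀ with ⊆-or-∉ {X = H} {Y = U₀} dimH (∈? {X = U₀} dimU₀)
    ... | inj₁ H⊆U₀ =
      contradiction (⊂⇒dim< {X = H} {Y = U₀} dimH dimU₀ H⊆U₀ e∈U₀ e∉H) (ℕ.<-irrefl refl)
    ... | inj₂ y = y

    y : V (ℕ.suc d)
    y = proj₁ H⊈U₀

    y∈H : y ∈ˢ H
    y∈H = proj₁ (proj₂ H⊈U₀)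

    y∉U₀ : ¬ y ∈ˢ U₀
    y∉U₀ = proj₂ (proj₂ H⊈U₀)

    z : Carrier → V (ℕ.suc d)
    z s = e ⊕ (- s) ⊙ y

    z∉H : ∀ s → ¬ z s ∈ˢ H
    z∉H s zs∈H = e∉H (+⟨⟩-⊆ H y {Y = H} (λ _ v∈H → v∈H) y∈H e (s , zs∈H))

    U₀∩H⊆hyperplane : ∀ j → U₀ ∩ˢ H ⊆ˢ U (hyperplane j)
    U₀∩H⊆hyperplane j = ∩H⊆hyperplane {i = hyperplane j₀} (hyperplane-is j)

    y∉hyperplane : ∀ j → ¬ y ∈ˢ U (hyperplane j)
    y∉hyperplane j y∈Uj = y∉U₀ (∩H⊆hyperplane (hyperplane-is j₀) y (y∈Uj , y∈H))

    e∈hyperplane+⟨y⟩ : ∀ j → e ∈ˢ U (hyperplane j) +⟨ y ⟩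
    e∈hyperplane+⟨y⟩ j = hyperplane-+⟨⟩ {X = U (hyperplane j)} (dimHyperplane (hyperplane-is j)) (y∉hyperplane j) e

    slope : Fin m → Carrier
    slope j = proj₁ (e∈hyperplane+⟨y⟩ j)

    z-slope : ∀ j → z (slope j) ∈ˢ U (hyperplane j)
    z-slope j = proj₂ (e∈hyperplane+⟨y⟩ j)

    slope-unique : ∀ {j s} → z s ∈ˢ U (hyperplane j) → s ≡ slope j
    slope-unique {j} zs∈Uj = +⟨⟩-unique (U (hyperplane j)) (y∉hyperplane j) zs∈Uj (z-slope j)

    slope-injective : Injective _≡_ _≡_ slope
    slope-injective {j} {j′} eq = hyperplane-injective
      (part-unique (z∉H (slope j)) (z-slope j) (subst (λ s → z s ∈ˢ U (hyperplane j′)) (sym eq) (z-slope j′)))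

    through-slope : ∀ j → (U₀ ∩ˢ H) +⟨ z (slope j) ⟩ ⊆ˢ U (hyperplane j)
    through-slope j = +⟨⟩-⊆ (U₀ ∩ˢ H) (z (slope j)) {Y = U (hyperplane j)} (U₀∩H⊆hyperplane j) (z-slope j)

    -- Write w = u + t·y with u ∈ U₀ and u = h + a·e with h ∈ H∞; then a ≠ 0 and w = h + a·z(−t/a).
    decomposition : ∀ w → ¬ w ∈ˢ H → ∃ λ s → w ∈ˢ (U₀ ∩ˢ H) +⟨ z s ⟩
    decomposition w w∉H = - (a⁻¹ * t) , a , ∈-resp (U₀ ∩ˢ H) (h∈U₀ , h∈H) h≋w-az
      where
      w∈U₀+⟨y⟩ = hyperplane-+⟨⟩ {X = U₀} dimU₀ y∉U₀ w
      t = proj₁ w∈U₀+⟨y⟩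
      u = w ⊕ (- t) ⊙ y
      u∈H+⟨e⟩ = hyperplane-+⟨⟩ {X = H} dimH e∉H u
      a = proj₁ u∈H+⟨e⟩
      h = u ⊕ (- a) ⊙ e
      h∈H : h ∈ˢ H
      h∈H = proj₂ u∈H+⟨e⟩
      h∈U₀ : h ∈ˢ U₀
      h∈U₀ = mem-+ U₀ (proj₂ w∈U₀+⟨y⟩) (mem-· U₀ (- a) e∈U₀)
      a≢0 : a ≢ 0#
      a≢0 a≡0 = w∉H (+⟨⟩-⊆ H y {Y = H} (λ _ v∈H → v∈H) y∈H w
                       (t , ∈-resp H h∈H (λ x → trans (+-comm _ _) (zero-*-+ _ _ (trans (cong -_ a≡0) -0#≈0#)))))
      a⁻¹ = inv a a≢0
      h≋w-az : h ≋ w ⊕ (- a) ⊙ z (- (a⁻¹ * t))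
      h≋w-az x = begin
        (w x + (- t) * y x) + (- a) * e x
          ≡⟨ cong (λ c → (w x + (- c) * y x) + (- a) * e x) (sym a*a⁻¹*t≡t) ⟩
        (w x + (- ((a * a⁻¹) * t)) * y x) + (- a) * e x
          ≡⟨ regroup (w x) (y x) a a⁻¹ t (e x) ⟩
        w x + (- a) * (e x + (- - (a⁻¹ * t)) * y x) ∎
        where
        open ≡-Reasoning
        a*a⁻¹*t≡t : (a * a⁻¹) * t ≡ t
        a*a⁻¹*t≡t = trans (cong (_* t) (*-inverseʳ a≢0)) (*-identityˡ t)
        regroup : ∀ w y a a⁻¹ t e →
                  (w + (- ((a * a⁻¹) * t)) * y) + (- a) * e ≡ w + (- a) * (e + (- - (a⁻¹ * t)) * y)
        regroup = solve 6 (λ w y a a⁻¹ t e → (w :+ (:- ((a :* a⁻¹) :* t)) :* y) :+ (:- a) :* e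
                                           := w :+ (:- a) :* (e :+ (:- :- (a⁻¹ :* t)) :* y)) refl

    b : Fin d → V (ℕ.suc d)
    b = proj₁ dimU₀

    b∈U₀ : ∀ k → b k ∈ˢ U₀
    b∈U₀ = proj₁ (proj₂ dimU₀)

    b-independent : LinearlyIndependent F b
    b-independent = proj₁ (proj₂ (proj₂ dimU₀))

    κ : Fin d → Carrier
    κ k = proj₁ (hyperplane-+⟨⟩ {X = H} dimH e∉H (b k))

    h : Fin d → V (ℕ.suc d)
    h k = b k ⊕ (- κ k) ⊙ e

    h∈U₀∩H : ∀ k → h k ∈ˢ U₀ ∩ˢ H
    h∈U₀∩H k = mem-+ U₀ (b∈U₀ k) (mem-· U₀ (- κ k) e∈U₀) ,
               proj₂ (hyperplane-+⟨⟩ {X = H} dimH e∉H (b k))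

    -- If every h k vanished, the d ≥ 2 independent vectors b k would all be multiples of e.
    nonzero-in-U₀∩H : 2 ℕ.≤ d → ∃ λ k → k ∈ˢ U₀ ∩ˢ H × ¬ k ≋ 𝟎
    nonzero-in-U₀∩H 2≤d with ∀-or-counterexample (↔-id _) (λ k → h k ≋? 𝟎)
    ... | inj₂ (k , hk≉0) = h k , h∈U₀∩H k , hk≉0
    ... | inj₁ h≋0 = contradiction (independent⇒≤ (λ (_ : Fin 1) → e) b-independent b∈⟨e⟩) (ℕ.<⇒≱ 2≤d)
      where
      b∈⟨e⟩ : ∀ k → ∃ λ c → b k ≋ lc c (λ _ → e)
      b∈⟨e⟩ k = (λ _ → κ k) , λ x → begin
        b k x                ≡⟨ inverseˡ-unique _ _ (h≋0 k x) ⟩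
        - ((- κ k) * e x)    ≡⟨ solve 2 (λ κ e → :- ((:- κ) :* e) := κ :* e) refl (κ k) (e x) ⟩
        κ k * e x            ≡⟨ sym (+-identityʳ _) ⟩
        κ k * e x + 0#       ∎
        where open ≡-Reasoning

    module AllSlopes (all-hit : ∀ s → Hits slope s) where

      in-hyperplane : ∀ w → ¬ w ∈ˢ H → ∃ λ j → w ∈ˢ U (hyperplane j)
      in-hyperplane w w∉H =
        let s , w∈ = decomposition w w∉H
            j , slope-j≡s = all-hit s
        in j , through-slope j w (subst (λ s → w ∈ˢ (U₀ ∩ˢ H) +⟨ z s ⟩) (sym slope-j≡s) w∈)

      all-hyperplanes : ∀ i → Hyperplane i
      all-hyperplanes i =
        let a , a∈Ui , a∉H = affine-point i
            j , a∈Uj = in-hyperplane a a∉H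
        in subst Hyperplane (part-unique a∉H a∈Uj a∈Ui) (hyperplane-is j)

      m≡q : m ≡ q
      m≡q = ℕ.≤-antisym (injective⇒≤ enumeration slope-injective) (surjective⇒≥ enumeration slope all-hit)

      not-tight : 2 ℕ.≤ d → ¬ Tight F U
      not-tight 2≤d tight =
        let k , k∈U₀∩H , k≉0 = nonzero-in-U₀∩H 2≤d
        in k≉0 (tight k (λ i → ∩H⊆hyperplane {i = hyperplane j₀} (all-hyperplanes i) k k∈U₀∩H))

    module Reduction (sx : Carrier) (sx-missed : ¬ Hits slope sx) (others-hit : ∀ s → s ≡ sx ⊎ Hits slope s) where

      zx : V (ℕ.suc d)
      zx = z sx

      W : Subspace F (ℕ.suc d)
      W = (U₀ ∩ˢ H) +⟨ zx ⟩

      zx∈W : zx ∈ˢ W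
      zx∈W = ∈-+⟨⟩ (U₀ ∩ˢ H) zx

      W∩hyperplane⊆H : ∀ {w j} → w ∈ˢ W → w ∈ˢ U (hyperplane j) → w ∈ˢ H
      W∩hyperplane⊆H {w} {j} (a , w-azx∈U₀∩H) w∈Uj = by-coefficient (a ≟ 0#)
        where
        by-coefficient : Dec (a ≡ 0#) → w ∈ˢ H
        by-coefficient (yes a≡0) = ∈-resp H (proj₂ w-azx∈U₀∩H)
                                     (λ x → trans (+-comm _ _) (zero-*-+ _ _ (trans (cong -_ a≡0) -0#≈0#)))
        by-coefficient (no a≢0) = contradiction (j , sym (slope-unique zx∈Uj)) sx-missed
          where zx∈Uj = +⟨⟩-cancel (U (hyperplane j)) w∈Uj (U₀∩H⊆hyperplane j _ w-azx∈U₀∩H) a≢0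

      in-W-or-hyperplane : ∀ w → ¬ w ∈ˢ H → w ∈ˢ W ⊎ ∃ λ j → w ∈ˢ U (hyperplane j)
      in-W-or-hyperplane w w∉H = by-slope (decomposition w w∉H)
        where
        by-slope : (∃ λ s → w ∈ˢ (U₀ ∩ˢ H) +⟨ z s ⟩) → w ∈ˢ W ⊎ ∃ λ j → w ∈ˢ U (hyperplane j)
        by-slope (s , w∈) with others-hit s
        ... | inj₁ refl = inj₁ w∈
        ... | inj₂ (j , slope-j≡s) =
              inj₂ (j , through-slope j w (subst (λ s → w ∈ˢ (U₀ ∩ˢ H) +⟨ z s ⟩) (sym slope-j≡s) w∈))

      -- The basis b k = h k + κ k·e of U₀ becomes a basis of W on replacing e by zx.
      φ : Fin d → V (ℕ.suc d)
      φ k = b k ⊕ (κ k * (- sx)) ⊙ y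

      φ∈W : ∀ k → φ k ∈ˢ W
      φ∈W k = κ k , ∈-resp (U₀ ∩ˢ H) (h∈U₀∩H k) (λ x → sym (regroup (b k x) (κ k) sx (y x) (e x)))
        where
        regroup : ∀ b κ s y e → (b + (κ * (- s)) * y) + (- κ) * (e + (- s) * y) ≡ b + (- κ) * e
        regroup = solve 5 (λ b κ s y e → (b :+ (κ :* (:- s)) :* y) :+ (:- κ) :* (e :+ (:- s) :* y)
                                          := b :+ (:- κ) :* e) refl

      φ-spans : ∀ v → v ∈ˢ W → ∃ λ c → v ≋ lc c φ
      φ-spans v (a , k∈U₀∩H) = c , v≋cφ
        where
        k = v ⊕ (- a) ⊙ zx
        k+ae∈⟨b⟩ = proj₂ (proj₂ (proj₂ dimU₀)) _ (mem-+ U₀ (proj₁ k∈U₀∩H) (mem-· U₀ a e∈U₀))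
        c = proj₁ k+ae∈⟨b⟩
        k+ae≋cb = proj₂ k+ae∈⟨b⟩
        σ = sum (λ i → c i * κ i)
        cb≋ch+σe : lc c b ≋ lc c h ⊕ σ ⊙ e
        cb≋ch+σe x = trans (lc-congʳ c (λ i x → sym (restore (b i x) (κ i) (e x))) x) (lc-shift c κ h e x)
          where
          restore : ∀ b κ e → (b + (- κ) * e) + κ * e ≡ b
          restore = solve 3 (λ b κ e → (b :+ (:- κ) :* e) :+ κ :* e := b) refl
        a≡σ : a ≡ σ
        a≡σ = +⟨⟩-unique H e∉H
          (∈-resp H (proj₂ k∈U₀∩H) (λ x → sym (cancel (k x) a (e x))))
          (∈-resp H (∈-lincomb H c h (proj₂ ∘ h∈U₀∩H))
                    (λ x → sym (trans (cong (_+ (- σ) * e x) (trans (k+ae≋cb x) (cb≋ch+σe x))) (cancel _ σ (e x)))))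
          where
          cancel : ∀ k a e → (k + a * e) + (- a) * e ≡ k
          cancel = solve 3 (λ k a e → (k :+ a :* e) :+ (:- a) :* e := k) refl
        v≋cφ : v ≋ lc c φ
        v≋cφ x = begin
          v x                                                ≡⟨ expand (v x) a (e x) sx (y x) ⟩
          (k x + a * e x) + (a * (- sx)) * y x
            ≡⟨ cong₂ (λ t u → t + (u * (- sx)) * y x) (k+ae≋cb x) a≡σ ⟩
          lc c b x + (σ * (- sx)) * y x                      ≡⟨ cong (λ t → lc c b x + t * y x) σ*-sx ⟩
          lc c b x + sum (λ i → c i * (κ i * (- sx))) * y x  ≡⟨ sym (lc-shift c (λ i → κ i * (- sx)) b y x) ⟩
          lc c φ x                                           ∎
          where
          open ≡-Reasoning
          expand : ∀ v a e s y → v ≡ ((v + (- a) * (e + (- s) * y)) + a * e) + (a * (- s)) * y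
          expand = solve 5 (λ v a e s y → v := ((v :+ (:- a) :* (e :+ (:- s) :* y)) :+ a :* e) :+ (a :* (:- s)) :* y) refl
          σ*-sx : σ * (- sx) ≡ sum (λ i → c i * (κ i * (- sx)))
          σ*-sx = trans (*-distribʳ-sum (- sx) (λ i → c i * κ i)) (sum-cong-≗ (λ i → *-assoc (c i) (κ i) (- sx)))

      dimW : HasDim F W d
      dimW = φ , φ∈W , independent-shift {X = U₀} b∈U₀ b-independent y∉U₀ (λ k → κ k * (- sx)) , φ-spans

      U⊆W : ∀ i → i ∈ nonHyperplanes → U i ⊆ˢ W
      U⊆W i i∈S = affine-part-⊆ {H = H} H? {X = U i} {W = W} (proj₁ (proj₂ (affine-point i)))
                                 (proj₂ (proj₂ (affine-point i))) outside⊆W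
        where
        outside⊆W : ∀ v → v ∈ˢ U i → ¬ v ∈ˢ H → v ∈ˢ W
        outside⊆W v v∈Ui v∉H = [ id , in-hyperplane⇒⊥ ]′ (in-W-or-hyperplane v v∉H)
          where
          in-hyperplane⇒⊥ : (∃ λ j → v ∈ˢ U (hyperplane j)) → v ∈ˢ W
          in-hyperplane⇒⊥ (j , v∈Uj) =
            contradiction (subst Hyperplane (part-unique v∉H v∈Uj v∈Ui) (hyperplane-is j)) (∈nonHyperplanes⁻ i∈S)

      cover : ∀ v → v ∈ˢ W → ¬ v ∈ˢ H →
              ∃ λ i → i ∈ nonHyperplanes × v ∈ˢ U i × (∀ j → j ∈ nonHyperplanes → v ∈ˢ U j → j ≡ i)
      cover v v∈W v∉H = part v v∉H , ∈nonHyperplanes⁺ ¬hyp , ∈-part v v∉H ,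
                        λ j _ v∈Uj → part-unique v∉H v∈Uj (∈-part v v∉H)
        where
        ¬hyp : ¬ Hyperplane (part v v∉H)
        ¬hyp hyp = let j , hyperplane-j≡ = hyperplane-surjective _ hyp
                   in v∉H (W∩hyperplane⊆H v∈W (subst (λ i → v ∈ˢ U i) (sym hyperplane-j≡) (∈-part v v∉H)))

      -- zx lies in some U i₁ ⊆ W; as U i₁ is not a hyperplane, W ⊈ U i₁, and a point of W outside
      -- both H∞ and U i₁ lies in another part.
      1<∣nonHyperplanes∣ : 1 ℕ.< ∣ nonHyperplanes ∣
      1<∣nonHyperplanes∣ =
        let i₁ , i₁∈S , zx∈Ui₁ , _ = cover zx zx∈W (z∉H sx)
        in second-member i₁∈S zx∈Ui₁ (⊆-or-∉ {X = W} {Y = U i₁} dimW (∈? {X = U i₁} (dimU i₁)))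
        where
        second-member : ∀ {i₁} → i₁ ∈ nonHyperplanes → zx ∈ˢ U i₁ →
                        W ⊆ˢ U i₁ ⊎ (∃ λ w → w ∈ˢ W × ¬ w ∈ˢ U i₁) → 1 ℕ.< ∣ nonHyperplanes ∣
        second-member {i₁} i₁∈S _ (inj₁ W⊆Ui₁) =
          contradiction (ℕ.≤-antisym (⊆⇒dim≤ {X = U i₁} {Y = W} (dimU i₁) dimW (U⊆W i₁ i₁∈S))
                                     (⊆⇒dim≤ {X = W} {Y = U i₁} dimW (dimU i₁) W⊆Ui₁))
                        (∈nonHyperplanes⁻ i₁∈S)
        second-member {i₁} i₁∈S zx∈Ui₁ (inj₂ (w , w∈W , w∉Ui₁)) =
          let v , v∈W , v∉H , v∉Ui₁ =
                outside-both {H = H} H? {W = W} {Y = U i₁} zx∈W zx∈Ui₁ (z∉H sx) w∈W w∉Ui₁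
              i₂ , i₂∈S , v∈Ui₂ , _ = cover v v∈W v∉H
          in two-members⇒1<∣∣ (λ i₁≡i₂ → v∉Ui₁ (subst (λ i → v ∈ˢ U i) (sym i₁≡i₂) v∈Ui₂))
                              i₁∈S i₂∈S

      reducible : Reducible F U H
      reducible = W , nonHyperplanes , (d , dimW , ℕ.≤-refl) , (λ W⊆H → z∉H sx (W⊆H zx zx∈W)) ,
                  1<∣nonHyperplanes∣ ,
                  (hyperplane j₀ , λ i₀∈S → ∈nonHyperplanes⁻ i₀∈S (hyperplane-is j₀)) ,
                  U⊆W , (λ i _ → proj₁ (proj₂ (proj₂ avsp)) i) , cover

    conclusion : 2 ℕ.≤ d → Irreducible F U H → m ℕ.≤ q ℕ.∸ 2 ⊎ (m ≡ q × ¬ Tight F U)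
    conclusion 2≤d irreducible = by-image (image-trichotomy enumeration slope-injective)
      where
      by-image : (∀ s → Hits slope s) ⊎ (∃ λ sx → ¬ Hits slope sx × ∀ s → s ≡ sx ⊎ Hits slope s) ⊎
                 m ℕ.≤ q ℕ.∸ 2 → m ℕ.≤ q ℕ.∸ 2 ⊎ (m ≡ q × ¬ Tight F U)
      by-image (inj₁ all-hit) = inj₂ (AllSlopes.m≡q all-hit , AllSlopes.not-tight all-hit 2≤d)
      by-image (inj₂ (inj₁ (sx , missed , others-hit))) =
        contradiction (Reduction.reducible sx missed others-hit) irreducible
      by-image (inj₂ (inj₂ m≤q∸2)) = inj₁ m≤q∸2

  conclusion : 2 ℕ.≤ d → Irreducible F U H → m ℕ.≤ q ℕ.∸ 2 ⊎ (m ≡ q × ¬ Tight F U)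
  conclusion 2≤d irreducible with m ℕ.≤? q ℕ.∸ 2
  ... | yes m≤q∸2 = inj₁ m≤q∸2
  ... | no m≰q∸2 = Pencil.conclusion (fromℕ< (ℕ.≤-<-trans ℕ.z≤n (ℕ.≰⇒> m≰q∸2))) 2≤d irreducible

mainTheorem10 : (q n r : ℕ) (F : FiniteField q) → 3 ≤ n →
    (U : Fin r → Subspace F n) (H : Subspace F n) →
    (dims : Fin r → ℕ) → (∀ i → HasDim F (U i) (dims i)) →
    IsAVSP F U H → Irreducible F U H →
    (count dims (n ∸ 1) ≤ q ∸ 2) ⊎ (count dims (n ∸ 1) ≡ q × ¬ Tight F U)
mainTheorem10 q (ℕ.suc d) r F (ℕ.s≤s 2≤d) U H dims dimU avsp irreducible =
  AffinePartition.conclusion F U H dims dimU avsp 2≤d irreducible
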